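{- For every KAM configuration $C$, we have $C \to^{*} \langle \lambda x.t, [\,]\rangle$ for some $x$ and $t$ if and only if $\llbracket C\rrbracket$ has a weak observable action on $\overline{b}$ with respect to the empty set of hidden names, i.e., there exist $P', Q, R$ such that $\llbracket C\rrbracket \stackrel{\tau}{\Longrightarrow} P'$ and $P' \xrightarrow{\overline{b}\langle Q\rangle} R$.
   Context: HOcore. Let $a,b,\dots$ range over channel names and $x,y,\dots$ over process variables. Processes are $P,Q ::= a(x).P \mid \overline{a}\langle P\rangle \mid P\parallel Q \mid x \mid 0$. In $a(x).P$ the variable $x$ is bound in $P$. Parallel composition is considered associative and commutative with neutral element $0$. The labelled transition system has labels $\tau$, $\overline{a}\langle P\rangle$ and $a(P)$, given by: $\overline{a}\langle P\rangle \xrightarrow{\overline{a}\langle P\rangle} 0$; $a(x).Q \xrightarrow{a(P)} Q\{P/x\}$ for every process $P$; if $P\xrightarrow{l}P'$ then $P\parallel Q\xrightarrow{l}P'\parallel Q$ (and symmetrically); if $P\xrightarrow{\overline{a}\langle R\rangle}P'$ and $Q\xrightarrow{a(R)}Q'$ then $P\parallel Q\xrightarrow{\tau}P'\parallel Q'$ (and symmetrically). $\stackrel{\tau}{\Longrightarrow}$ is the reflexive-transitive closure of $\xrightarrow{\tau}$. KAM. Terms $t,s ::= x \mid t\,s \mid \lambda x.t$; closed terms have no free variables. Stacks $\pi ::= t::\pi \mid [\,]$. Configurations $\langle t,\pi\rangle$ with $t$ and all elements of $\pi$ closed. Transitions: $\langle t\,s,\pi\rangle \to \langle t, s::\pi\rangle$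 and $\langle \lambda x.t, s::\pi\rangle \to \langle t\{s/x\},\pi\rangle$. Translation (channel names $hd,c,b$; $\lambda$-variables identified with process variables; $p$ not free in translated entities): $\llbracket [\,]\rrbracket = \overline{b}\langle 0\rangle$; $\llbracket t::\pi\rrbracket = \overline{hd}\langle \llbracket t\rrbracket\rangle \parallel \overline{c}\langle\llbracket \pi\rrbracket\rangle$; $\llbracket\langle t,\pi\rangle\rrbracket = \llbracket t\rrbracket \parallel \overline{c}\langle \llbracket \pi\rrbracket\rangle$; $\llbracket t\,s\rrbracket = c(p).(\llbracket t\rrbracket \parallel \overline{c}\langle \overline{hd}\langle\llbracket s\rrbracket\rangle \parallel \overline{c}\langle p\rangle\rangle)$; $\llbracket \lambda x.t\rrbracket = c(p).(hd(x).\llbracket t\rrbracket \parallel p)$; $\llbracket x\rrbracket = x$. -}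

module Defs where

open import Data.Nat using (ℕ; zero; suc)
open import Data.Nat.Properties using (_≟_)
open import Data.List using (List; []; _∷_)
open import Data.List.Relation.Unary.All using (All)
open import Data.Product using (Σ; ∃; _×_; _,_)
open import Relation.Nullary using (¬_; yes; no)
open import Relation.Binary.PropositionalEquality using (_≡_)
open import Relation.Binary.Construct.Closure.ReflexiveTransitive using (Star)

Chan : Set
Chan = ℕ

hd c b : Chan
hd = 0
c  = 1
b  = 2

-- Process variables: the λ-variables (identified with process variables
-- via the constructor lv) plus one extra variable p, which is thereby
-- guaranteed not to be free in any translated entity.
data PVar : Set where
  lv : ℕ → PVar
  pv : PVar

_≟v_ : (x y : PVar) → Relation.Nullary.Dec (x ≡ y)
lv m ≟v lv n with m ≟ n
... | yes Relation.Binary.PropositionalEquality.refl = yes Relation.Binary.PropositionalEquality.refl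
... | no ne = no λ { Relation.Binary.PropositionalEquality.refl → ne Relation.Binary.PropositionalEquality.refl }
lv m ≟v pv = no λ ()
pv ≟v lv n = no λ ()
pv ≟v pv = yes Relation.Binary.PropositionalEquality.refl

infixr 5 _∥_
data Proc : Set where
  inp  : Chan → PVar → Proc → Proc
  out  : Chan → Proc → Proc
  _∥_  : Proc → Proc → Proc
  var  : PVar → Proc
  nil  : Proc

-- It is only ever applied with closed Q along the
-- transitions relevant here (processes communicated by closed processes
-- are closed), where it coincides with capture-avoiding substitution.
_[_/_]ᴾ : Proc → Proc → PVar → Proc
inp a y P [ Q / x ]ᴾ with y ≟v x
... | yes _ = inp a y P
... | no  _ = inp a y (P [ Q / x ]ᴾ)
out a P   [ Q / x ]ᴾ = out a (P [ Q / x ]ᴾ)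
(P ∥ P')  [ Q / x ]ᴾ = (P [ Q / x ]ᴾ) ∥ (P' [ Q / x ]ᴾ)
var y     [ Q / x ]ᴾ with y ≟v x
... | yes _ = Q
... | no  _ = var y
nil       [ Q / x ]ᴾ = nil

data Label : Set where
  τ    : Label
  outL : Chan → Proc → Label
  inL  : Chan → Proc → Label

-- Labelled transition system (parallel rules given symmetrically, so
-- the AC-with-unit structure of ∥ need not be quotiented).
data _─[_]→_ : Proc → Label → Proc → Set where
  out-ax : ∀ {a P} → out a P ─[ outL a P ]→ nil
  inp-ax : ∀ {a x Q} P → inp a x Q ─[ inL a P ]→ (Q [ P / x ]ᴾ)
  parL   : ∀ {P P' Q l} → P ─[ l ]→ P' → (P ∥ Q) ─[ l ]→ (P' ∥ Q)
  parR   : ∀ {P Q Q' l} → Q ─[ l ]→ Q' → (P ∥ Q) ─[ l ]→ (P ∥ Q')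
  commL  : ∀ {P P' Q Q' a R} → P ─[ outL a R ]→ P' → Q ─[ inL a R ]→ Q' →
           (P ∥ Q) ─[ τ ]→ (P' ∥ Q')
  commR  : ∀ {P P' Q Q' a R} → P ─[ inL a R ]→ P' → Q ─[ outL a R ]→ Q' →
           (P ∥ Q) ─[ τ ]→ (P' ∥ Q')

τstep : Proc → Proc → Set
τstep P Q = P ─[ τ ]→ Q

_⇒τ_ : Proc → Proc → Set
_⇒τ_ = Star τstep

data Term : Set where
  ‵_  : ℕ → Term
  _·_ : Term → Term → Term
  ƛ_⇒_ : ℕ → Term → Term

data _∈fv_ : ℕ → Term → Set where
  fv-var : ∀ {x} → x ∈fv (‵ x)
  fv-l   : ∀ {x t s} → x ∈fv t → x ∈fv (t · s)
  fv-r   : ∀ {x t s} → x ∈fv s → x ∈fv (t · s)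
  fv-lam : ∀ {x y t} → ¬ (x ≡ y) → x ∈fv t → x ∈fv (ƛ y ⇒ t)

Closed : Term → Set
Closed t = ∀ x → ¬ (x ∈fv t)

-- substitution t{s/x} (only used with closed s, where no capture occurs)
_[_/_] : Term → Term → ℕ → Term
(‵ y) [ s / x ] with y ≟ x
... | yes _ = s
... | no  _ = ‵ y
(t · u) [ s / x ] = (t [ s / x ]) · (u [ s / x ])
(ƛ y ⇒ t) [ s / x ] with y ≟ x
... | yes _ = ƛ y ⇒ t
... | no  _ = ƛ y ⇒ (t [ s / x ])

Stack : Set
Stack = List Term

record Config : Set where
  constructor ⟨_,_⟩[_,_]
  field
    term      : Term
    stack     : Stack
    termClosed  : Closed term
    stackClosed : All Closed stack

-- KAM transitions (on the underlying pairs; closedness is preserved)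
data _↦_ : Term × Stack → Term × Stack → Set where
  push : ∀ {t s π} → ((t · s) , π) ↦ (t , (s ∷ π))
  grab : ∀ {x t s π} → ((ƛ x ⇒ t) , (s ∷ π)) ↦ ((t [ s / x ]) , π)

_↦*_ : Term × Stack → Term × Stack → Set
_↦*_ = Star _↦_

p : PVar
p = pv

⟦_⟧t : Term → Proc
⟦ ‵ x ⟧t     = var (lv x)
⟦ t · s ⟧t   = inp c p (⟦ t ⟧t ∥ out c (out hd ⟦ s ⟧t ∥ out c (var p)))
⟦ ƛ x ⇒ t ⟧t = inp c p (inp hd (lv x) ⟦ t ⟧t ∥ var p)

⟦_⟧s : Stack → Proc
⟦ [] ⟧s    = out b nil
⟦ t ∷ π ⟧s = out hd ⟦ t ⟧t ∥ out c ⟦ π ⟧s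

⟦_⟧ : Config → Proc
⟦ C ⟧ = ⟦ Config.term C ⟧t ∥ out c ⟦ Config.stack C ⟧s

WeakBarb-b : Proc → Set
WeakBarb-b P = ∃ λ P' → ∃ λ Q → ∃ λ R → (P ⇒τ P') × (P' ─[ outL b Q ]→ R)

{-# OPTIONS --safe #-}
module Submission where

-- The translation is a strong operational correspondence up to the unit
-- laws of ∥.  A push step is simulated by one τ-step and a grab step by two
-- (the λ first takes the stack, then its head); conversely every τ-step of
-- a translated state, or of the intermediate state of a grab, leads up to
-- units to a state of the same kind, reached by KAM steps.  The only b̄-barb
-- of these states is the empty stack exposed by a λ, i.e. by a final
-- configuration.

open import Defs
open import Data.Empty using (⊥-elim)
open import Data.List using ([]; _∷_)
open import Data.Nat using (ℕ)
open import Data.Nat.Properties using (_≟_)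
open import Data.Product using (∃; _,_; _×_)
open import Function.Bundles using (_⇔_; mk⇔)
open import Relation.Nullary using (¬_; yes; no)
open import Relation.Binary.PropositionalEquality using (_≡_; refl; sym; cong; cong₂)
open import Relation.Binary.Construct.Closure.ReflexiveTransitive using (ε; _◅_; _◅◅_)

⟦_⟧ₖ : Term × Stack → Proc
⟦ t , π ⟧ₖ = ⟦ t ⟧t ∥ out c ⟦ π ⟧s

⟦⟧t-p-fresh : ∀ t Q → ⟦ t ⟧t [ Q / p ]ᴾ ≡ ⟦ t ⟧t
⟦⟧t-p-fresh (‵ x)     Q = refl
⟦⟧t-p-fresh (t · s)   Q = refl
⟦⟧t-p-fresh (ƛ x ⇒ t) Q = refl

⟦⟧t-subst : ∀ t s x → ⟦ t [ s / x ] ⟧t ≡ ⟦ t ⟧t [ ⟦ s ⟧t / lv x ]ᴾ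
⟦⟧t-subst (‵ y) s x with y ≟ x
... | yes refl = refl
... | no  _    = refl
⟦⟧t-subst (t · u) s x =
  cong₂ (λ T U → inp c p (T ∥ out c (out hd U ∥ out c (var p))))
        (⟦⟧t-subst t s x) (⟦⟧t-subst u s x)
⟦⟧t-subst (ƛ y ⇒ t) s x with y ≟ x
... | yes refl = refl
... | no  _    = cong (λ T → inp c p (inp hd (lv y) T ∥ var p)) (⟦⟧t-subst t s x)

⟦⟧t-no-output : ∀ t {a Q P} → ¬ (⟦ t ⟧t ─[ outL a Q ]→ P)
⟦⟧t-no-output (‵ x)     ()
⟦⟧t-no-output (t · s)   ()
⟦⟧t-no-output (ƛ x ⇒ t) ()

infix 4 _≈_
data _≈_ : Proc → Proc → Set where
  ≈-refl      : ∀ {P} → P ≈ P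
  ≈-trans     : ∀ {P Q R} → P ≈ Q → Q ≈ R → P ≈ R
  ∥-identityʳ : ∀ {P} → P ∥ nil ≈ P
  ∥-identityˡ : ∀ {P} → nil ∥ P ≈ P
  ∥-cong      : ∀ {P P' Q Q'} → P ≈ P' → Q ≈ Q' → P ∥ Q ≈ P' ∥ Q'

≡⇒≈ : ∀ {P Q} → P ≡ Q → P ≈ Q
≡⇒≈ refl = ≈-refl

≈-forth : ∀ {P S P' l} → P ≈ S → P ─[ l ]→ P' → ∃ λ S' → (S ─[ l ]→ S') × (P' ≈ S')
≈-forth ≈-refl st = _ , st , ≈-refl
≈-forth (≈-trans e₁ e₂) st with ≈-forth e₁ st
... | _ , st₁ , e₁' with ≈-forth e₂ st₁
... | _ , st₂ , e₂' = _ , st₂ , ≈-trans e₁' e₂'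
≈-forth ∥-identityʳ (parL st)   = _ , st , ∥-identityʳ
≈-forth ∥-identityʳ (parR ())
≈-forth ∥-identityʳ (commL _ ())
≈-forth ∥-identityʳ (commR _ ())
≈-forth ∥-identityˡ (parL ())
≈-forth ∥-identityˡ (parR st)   = _ , st , ∥-identityˡ
≈-forth ∥-identityˡ (commL () _)
≈-forth ∥-identityˡ (commR () _)
≈-forth (∥-cong e₁ e₂) (parL st) with ≈-forth e₁ st
... | _ , st' , e' = _ , parL st' , ∥-cong e' e₂
≈-forth (∥-cong e₁ e₂) (parR st) with ≈-forth e₂ st
... | _ , st' , e' = _ , parR st' , ∥-cong e₁ e'
≈-forth (∥-cong e₁ e₂) (commL st₁ st₂) with ≈-forth e₁ st₁ | ≈-forth e₂ st₂
... | _ , st₁' , e₁' | _ , st₂' , e₂' = _ , commL st₁' st₂' , ∥-cong e₁' e₂'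
≈-forth (∥-cong e₁ e₂) (commR st₁ st₂) with ≈-forth e₁ st₁ | ≈-forth e₂ st₂
... | _ , st₁' , e₁' | _ , st₂' , e₂' = _ , commR st₁' st₂' , ∥-cong e₁' e₂'

≈-back : ∀ {P S S' l} → P ≈ S → S ─[ l ]→ S' → ∃ λ P' → (P ─[ l ]→ P') × (P' ≈ S')
≈-back ≈-refl st = _ , st , ≈-refl
≈-back (≈-trans e₁ e₂) st with ≈-back e₂ st
... | _ , st₂ , e₂' with ≈-back e₁ st₂
... | _ , st₁ , e₁' = _ , st₁ , ≈-trans e₁' e₂'
≈-back ∥-identityʳ st = _ , parL st , ∥-identityʳ
≈-back ∥-identityˡ st = _ , parR st , ∥-identityˡ
≈-back (∥-cong e₁ e₂) (parL st) with ≈-back e₁ st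
... | _ , st' , e' = _ , parL st' , ∥-cong e' e₂
≈-back (∥-cong e₁ e₂) (parR st) with ≈-back e₂ st
... | _ , st' , e' = _ , parR st' , ∥-cong e₁ e'
≈-back (∥-cong e₁ e₂) (commL st₁ st₂) with ≈-back e₁ st₁ | ≈-back e₂ st₂
... | _ , st₁' , e₁' | _ , st₂' , e₂' = _ , commL st₁' st₂' , ∥-cong e₁' e₂'
≈-back (∥-cong e₁ e₂) (commR st₁ st₂) with ≈-back e₁ st₁ | ≈-back e₂ st₂
... | _ , st₁' , e₁' | _ , st₂' , e₂' = _ , commR st₁' st₂' , ∥-cong e₁' e₂'

≈-back-⇒τ : ∀ {P S S'} → P ≈ S → S ⇒τ S' → ∃ λ P' → (P ⇒τ P') × (P' ≈ S')
≈-back-⇒τ e ε = _ , ε , e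
≈-back-⇒τ e (st ◅ sts) with ≈-back e st
... | _ , st' , e' with ≈-back-⇒τ e' sts
... | _ , sts' , e'' = _ , st' ◅ sts' , e''

WeakBarb-b-≈ : ∀ {P S} → P ≈ S → WeakBarb-b S → WeakBarb-b P
WeakBarb-b-≈ e (_ , Q , _ , sts , barb) with ≈-back-⇒τ e sts
... | P' , sts' , e' with ≈-back e' barb
... | R , barb' , _ = P' , Q , R , sts' , barb'

WeakBarb-b-⇒τ : ∀ {P P'} → P ⇒τ P' → WeakBarb-b P' → WeakBarb-b P
WeakBarb-b-⇒τ sts (P'' , Q , R , sts' , barb) = P'' , Q , R , sts ◅◅ sts' , barb

λ-grabbed : ℕ → Term → Stack → Proc
λ-grabbed x u π = (inp hd (lv x) ⟦ u ⟧t ∥ ⟦ π ⟧s) ∥ nil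

var-stuck : ∀ y π {S} → ¬ (⟦ ‵ y , π ⟧ₖ ─[ τ ]→ S)
var-stuck y π (parL ())
var-stuck y π (parR ())
var-stuck y π (commL () _)
var-stuck y π (commR () _)

push-step : ∀ t s π {S} → ⟦ t · s , π ⟧ₖ ─[ τ ]→ S → S ≈ ⟦ t , s ∷ π ⟧ₖ
push-step t s π (parL ())
push-step t s π (parR ())
push-step t s π (commL () _)
push-step t s π (commR (inp-ax _) out-ax) =
  ≈-trans ∥-identityʳ
    (≡⇒≈ (cong₂ (λ T U → T ∥ out c (out hd U ∥ out c ⟦ π ⟧s))
                (⟦⟧t-p-fresh t ⟦ π ⟧s) (⟦⟧t-p-fresh s ⟦ π ⟧s)))

grab-step₁ : ∀ x u π {S} → ⟦ ƛ x ⇒ u , π ⟧ₖ ─[ τ ]→ S → S ≈ λ-grabbed x u π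
grab-step₁ x u π (parL ())
grab-step₁ x u π (parR ())
grab-step₁ x u π (commL () _)
grab-step₁ x u π (commR (inp-ax _) out-ax) =
  ≡⇒≈ (cong (λ U → (inp hd (lv x) U ∥ ⟦ π ⟧s) ∥ nil) (⟦⟧t-p-fresh u ⟦ π ⟧s))

grab-step₂ : ∀ x u s π {S} → λ-grabbed x u (s ∷ π) ─[ τ ]→ S → S ≈ ⟦ u [ s / x ] , π ⟧ₖ
grab-step₂ x u s π (parL (parL ()))
grab-step₂ x u s π (parL (parR (parL ())))
grab-step₂ x u s π (parL (parR (parR ())))
grab-step₂ x u s π (parL (parR (commL out-ax ())))
grab-step₂ x u s π (parL (parR (commR () _)))
grab-step₂ x u s π (parL (commL () _))
grab-step₂ x u s π (parL (commR (inp-ax _) (parL out-ax))) =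
  ≈-trans ∥-identityʳ (∥-cong (≡⇒≈ (sym (⟦⟧t-subst u s x))) ∥-identityˡ)
grab-step₂ x u s π (parL (commR (inp-ax _) (parR ())))
grab-step₂ x u s π (parR ())
grab-step₂ x u s π (commL _ ())
grab-step₂ x u s π (commR _ ())

λ-grabbed-[]-stuck : ∀ x u {S} → ¬ (λ-grabbed x u [] ─[ τ ]→ S)
λ-grabbed-[]-stuck x u (parL (parL ()))
λ-grabbed-[]-stuck x u (parL (parR ()))
λ-grabbed-[]-stuck x u (parL (commL () _))
λ-grabbed-[]-stuck x u (parL (commR (inp-ax _) ()))
λ-grabbed-[]-stuck x u (parR ())
λ-grabbed-[]-stuck x u (commL _ ())
λ-grabbed-[]-stuck x u (commR _ ())

⟦⟧ₖ-no-b-barb : ∀ k {Q R} → ¬ (⟦ k ⟧ₖ ─[ outL b Q ]→ R)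
⟦⟧ₖ-no-b-barb (t , π) (parL st) = ⟦⟧t-no-output t st
⟦⟧ₖ-no-b-barb (t , π) (parR ())

λ-grabbed-∷-no-b-barb : ∀ x u s π {Q R} → ¬ (λ-grabbed x u (s ∷ π) ─[ outL b Q ]→ R)
λ-grabbed-∷-no-b-barb x u s π (parL (parL ()))
λ-grabbed-∷-no-b-barb x u s π (parL (parR (parL ())))
λ-grabbed-∷-no-b-barb x u s π (parL (parR (parR ())))
λ-grabbed-∷-no-b-barb x u s π (parR ())

push-enabled : ∀ t s π → ∃ λ S → ⟦ t · s , π ⟧ₖ ─[ τ ]→ S
push-enabled t s π = _ , commR (inp-ax _) out-ax

grab-enabled₁ : ∀ x u π → ∃ λ S → ⟦ ƛ x ⇒ u , π ⟧ₖ ─[ τ ]→ S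
grab-enabled₁ x u π = _ , commR (inp-ax _) out-ax

grab-enabled₂ : ∀ x u s π → ∃ λ S → λ-grabbed x u (s ∷ π) ─[ τ ]→ S
grab-enabled₂ x u s π = _ , parL (commR (inp-ax _) (parL out-ax))

↦-simulation : ∀ {k k'} → k ↦ k' → ∃ λ S → (⟦ k ⟧ₖ ⇒τ S) × (S ≈ ⟦ k' ⟧ₖ)
↦-simulation (push {t} {s} {π}) =
  let S , step = push-enabled t s π
  in  S , step ◅ ε , push-step t s π step
↦-simulation (grab {x} {u} {s} {π}) =
  let _ , step₁ = grab-enabled₁ x u (s ∷ π)
      _ , step₂ = grab-enabled₂ x u s π
      S₂' , step₂' , e = ≈-back (grab-step₁ x u (s ∷ π) step₁) step₂
  in  S₂' , step₁ ◅ step₂' ◅ ε , ≈-trans e (grab-step₂ x u s π step₂)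

final-barb : ∀ x t → WeakBarb-b ⟦ ƛ x ⇒ t , [] ⟧ₖ
final-barb x t =
  let S , step = grab-enabled₁ x t []
      S' , barb , _ = ≈-back (grab-step₁ x t [] step) (parL (parR out-ax))
  in  S , nil , S' , step ◅ ε , barb

↦*-final⇒WeakBarb-b : ∀ {k x t} → k ↦* (ƛ x ⇒ t , []) → WeakBarb-b ⟦ k ⟧ₖ
↦*-final⇒WeakBarb-b {x = x} {t} ε = final-barb x t
↦*-final⇒WeakBarb-b (r ◅ rs) =
  let S , sts , e = ↦-simulation r
  in  WeakBarb-b-⇒τ sts (WeakBarb-b-≈ e (↦*-final⇒WeakBarb-b rs))

data Canonical : Term × Stack → Proc → Set where
  running  : ∀ {k} → Canonical k ⟦ k ⟧ₖ
  grabbing : ∀ {x u π} → Canonical (ƛ x ⇒ u , π) (λ-grabbed x u π)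

Canonical-τ : ∀ {k S S'} → Canonical k S → S ─[ τ ]→ S' →
  ∃ λ k' → ∃ λ S'' → (k ↦* k') × Canonical k' S'' × (S' ≈ S'')
Canonical-τ (running {‵ y , π})     st = ⊥-elim (var-stuck y π st)
Canonical-τ (running {t · s , π})   st = _ , _ , push ◅ ε , running , push-step t s π st
Canonical-τ (running {ƛ x ⇒ u , π}) st = _ , _ , ε , grabbing , grab-step₁ x u π st
Canonical-τ (grabbing {x} {u} {[]})    st = ⊥-elim (λ-grabbed-[]-stuck x u st)
Canonical-τ (grabbing {x} {u} {s ∷ π}) st =
  _ , _ , grab ◅ ε , running , grab-step₂ x u s π st

Canonical-b-barb : ∀ {k S Q R} → Canonical k S → S ─[ outL b Q ]→ R →
  ∃ λ x → ∃ λ t → k ≡ (ƛ x ⇒ t , [])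
Canonical-b-barb (running {k}) barb = ⊥-elim (⟦⟧ₖ-no-b-barb k barb)
Canonical-b-barb (grabbing {x} {u} {[]}) barb = x , u , refl
Canonical-b-barb (grabbing {x} {u} {s ∷ π}) barb =
  ⊥-elim (λ-grabbed-∷-no-b-barb x u s π barb)

Canonical-weak-b-barb⇒↦*-final : ∀ {k S P P' Q R} → Canonical k S → P ≈ S → P ⇒τ P' →
  P' ─[ outL b Q ]→ R → ∃ λ x → ∃ λ t → k ↦* (ƛ x ⇒ t , [])
Canonical-weak-b-barb⇒↦*-final cn e ε barb with ≈-forth e barb
... | _ , barb' , _ with Canonical-b-barb cn barb'
... | x , t , refl = x , t , ε
Canonical-weak-b-barb⇒↦*-final cn e (st ◅ sts) barb =
  let _ , st' , e' = ≈-forth e st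
      _ , _ , rs , cn' , e'' = Canonical-τ cn st'
      x , t , rs' = Canonical-weak-b-barb⇒↦*-final cn' (≈-trans e' e'') sts barb
  in  x , t , rs ◅◅ rs'

corollary3p2 : (C : Config) →
    (∃ λ (x : ℕ) → ∃ λ (t : Term) →
       (Config.term C , Config.stack C) ↦* ((ƛ x ⇒ t) , []))
    ⇔ WeakBarb-b ⟦ C ⟧
corollary3p2 C = mk⇔
  (λ (x , t , rs) → ↦*-final⇒WeakBarb-b rs)
  (λ (_ , _ , _ , sts , barb) → Canonical-weak-b-barb⇒↦*-final running ≈-refl sts barb)
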